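{- Let $R\subseteq[n-1]$ and let $\upsilon\in U_R(n)$, $\eta\in UGC_R(n)$, $\phi\in UF_R(n)$, $\alpha\in UI_R(n)$. (i) $\Delta_R(\upsilon)\in UI_R(n)$. (ii) $\Delta_R(\eta)$ and $\Delta_R(\phi)$ are gapless $R$-tuples; consequently $UG_R(n)\subseteq UGC_R(n)$ and $UF_R(n)\subseteq UGC_R(n)$. (iii) The $R$-critical list of $\upsilon$ is a flag $R$-critical list if and only if $\upsilon\in UGC_R(n)$. (iv) The $R$-critical list of $\alpha$ is a flag $R$-critical list if and only if $\alpha\in UG_R(n)$.
   Context: Fix $n\ge1$; $[m]=\{1,\dots,m\}$, $(a,b]=\{a+1,\dots,b\}$. Write $R=\{q_1<\cdots<q_r\}$, $q_0=0$, $q_{r+1}=n$, $p_h=q_h-q_{h-1}$, carrels $(q_{h-1},q_h]$. $R$-tuples $\nu\in[n]^n$; $U_R(n)$ upper ones ($\nu_i\ge i$); $UF_R(n)$ upper weakly increasing ones; $UI_R(n)$ upper ones strictly increasing on each carrel. Gapless $R$-tuple: $\gamma\in UI_R(n)$ such that for each $h\in[r]$ with $\gamma_{q_h}>\gamma_{q_h+1}$, $s=\gamma_{q_h}-\gamma_{q_h+1}+1\le p_{h+1}$ and $\gamma_{q_h+t}=\gamma_{q_h}-s+t$, $t=1,\dots,s$; $UG_R(n)$ their set. Critical indices of $\upsilon\in U_R(n)$: in carrel $h$, $x_1=q_h$, and while possible $x_u$ = largest $x\in(q_{h-1},x_{u-1})$ with $\upsilon_{x_{u-1}}-\upsilon_x>x_{u-1}-x$;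 the pairs $(x,\upsilon_x)$ for critical $x$, grouped by carrel, form the $R$-critical list of $\upsilon$. It is a flag $R$-critical list if the sequence of all critical entries $\upsilon_x$, ordered by increasing critical index $x$, is weakly increasing (equivalently, for each $h\in[r]$, $\upsilon_{q_h}\le\upsilon_k$ where $k$ is the smallest critical index in $(q_h,q_{h+1}]$). $R$-core $\Delta_R(\upsilon)$: equals $\upsilon_x$ at critical $x$ and $\upsilon_x-(x-i)$ at non-critical $i$, $x$ the smallest critical index $>i$. $UGC_R(n)=\{\upsilon\in U_R(n):\Delta_R(\upsilon)\in UG_R(n)\}$. -}

module Defs where

open import Data.Nat using (ℕ; zero; suc; _+_; _∸_; _≤_; _<_; _<ᵇ_)
open import Data.Bool using (Bool; true; false; if_then_else_)
open import Data.Maybe using (Maybe; just; nothing; maybe)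
open import Data.List using (List; []; _∷_; _++_; reverse; zip; concatMap; map)
open import Data.List.Membership.Propositional using (_∈_)
open import Data.List.Relation.Unary.All using (All)
open import Data.List.Relation.Unary.Linked using (Linked)
open import Data.Product using (_×_; _,_)
open import Relation.Nullary using (¬_)
open import Relation.Binary.PropositionalEquality using (_≡_)

-- Conventions.
-- * An R-tuple ν ∈ [n]^n is represented by a function ν : ℕ → ℕ, with
--   positions 1..n (1-based) and values in ℕ; only the positions 1..n are
--   ever inspected, and membership in [n] is imposed by `InRange`.
-- * R = {q₁ < ⋯ < q_r} ⊆ [n-1] is represented by the strictly increasing
--   list (q₁ ∷ ⋯ ∷ q_r ∷ []) (see `ValidR`).

Tuple : Set
Tuple = ℕ → ℕ

ValidR : ℕ → List ℕ → Set
ValidR n R = Linked _<_ R × All (λ q → 1 ≤ q × q < n) R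

InRange : ℕ → Tuple → Set
InRange n ν = ∀ i → 1 ≤ i → i ≤ n → 1 ≤ ν i × ν i ≤ n

U : List ℕ → ℕ → Tuple → Set
U R n ν = InRange n ν × (∀ i → 1 ≤ i → i ≤ n → i ≤ ν i)

UF : List ℕ → ℕ → Tuple → Set
UF R n ν = U R n ν × (∀ i → 1 ≤ i → i < n → ν i ≤ ν (suc i))

-- UI_R(n): upper, strictly increasing on each carrel
-- (i and i+1 lie in the same carrel iff i ∉ R)
UI : List ℕ → ℕ → Tuple → Set
UI R n ν = U R n ν × (∀ i → 1 ≤ i → i < n → ¬ (i ∈ R) → ν i < ν (suc i))

nextPairs : List ℕ → ℕ → List (ℕ × ℕ)
nextPairs [] n = []
nextPairs (q ∷ []) n = (q , n) ∷ []
nextPairs (q ∷ q' ∷ rest) n = (q , q') ∷ nextPairs (q' ∷ rest) n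

-- gapless condition at the boundary q = q_h, with q' = q_{h+1} (so p_{h+1} = q' - q)
GapCond : Tuple → ℕ × ℕ → Set
GapCond γ (q , q') =
  γ (suc q) < γ q →
    ((γ q ∸ γ (suc q) + 1) ≤ q' ∸ q)
    × (∀ t → 1 ≤ t → t ≤ γ q ∸ γ (suc q) + 1 →
         γ (q + t) ≡ (γ q ∸ (γ q ∸ γ (suc q) + 1)) + t)

UG : List ℕ → ℕ → Tuple → Set
UG R n γ = UI R n γ × All (GapCond γ) (nextPairs R n)

findBelow : (ℕ → Bool) → ℕ → ℕ → Maybe ℕ
findBelow P a zero = nothing
findBelow P a (suc y) with a <ᵇ y
... | false = nothing
... | true = if P y then just y else findBelow P a y

-- critical indices of υ in the carrel (a , y], starting from x₁ = y,
-- in decreasing order: x_u = largest x ∈ (a , x_{u-1}) with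
-- υ_{x_{u-1}} - υ_x > x_{u-1} - x  (i.e. υ_x + x_{u-1} < υ_{x_{u-1}} + x).
-- The fuel argument is always ≥ the current index, hence sufficient.
chain : Tuple → ℕ → ℕ → ℕ → List ℕ
chain υ a y zero = []
chain υ a y (suc f) =
  y ∷ maybe (λ x → chain υ a x f) []
            (findBelow (λ x → υ x + y <ᵇ υ y + x) a y)

-- carrels (q_{h-1} , q_h], h = 1 .. r+1
carrels : List ℕ → ℕ → List (ℕ × ℕ)
carrels R n = zip (0 ∷ R) (R ++ n ∷ [])

carrelCrit : Tuple → ℕ × ℕ → List ℕ
carrelCrit υ (a , b) = reverse (chain υ a b b)

criticalIndices : List ℕ → ℕ → Tuple → List ℕ
criticalIndices R n υ = concatMap (carrelCrit υ) (carrels R n)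

criticalList : List ℕ → ℕ → Tuple → List (List (ℕ × ℕ))
criticalList R n υ =
  map (λ c → map (λ x → x , υ x) (carrelCrit υ c)) (carrels R n)

FlagCritical : List ℕ → ℕ → Tuple → Set
FlagCritical R n υ = Linked _≤_ (map υ (criticalIndices R n υ))

firstGE : ℕ → List ℕ → Maybe ℕ
firstGE i [] = nothing
firstGE i (x ∷ xs) = if x <ᵇ i then firstGE i xs else just x

-- Positions outside [n] get the dummy value 0.
Δ : List ℕ → ℕ → Tuple → Tuple
Δ R n υ i = maybe (λ x → υ x ∸ (x ∸ i)) 0 (firstGE i (criticalIndices R n υ))

UGC : List ℕ → ℕ → Tuple → Set
UGC R n υ = U R n υ × UG R n (Δ R n υ)

-- Everything is driven by the list L of R-critical indices of υ.  After general facts about firstGE,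
-- successors in sorted lists and natural-number arithmetic, the module Core
-- derives from CriticalSpec alone that for upper υ the core is the affine
-- run j ↦ (υ_y − y) + j on each stretch (x, y] between consecutive critical
-- indices.  Consequently:
--  (i)   the core is upper, in range, and increases across every
--        non-boundary step, since a jump at a critical x ∉ R lifts the run;
--  (iii) at a boundary q with next critical index k the gap condition holds
--        when υ_q ≤ υ_k, and a gapless core forbids υ_k < υ_q, so gapless
--        cores are exactly those with flag critical lists;
--  (iv)  for υ ∈ UI_R(n) the core equals υ, as the core bound and strict
--        increase pin υ to its run;
--  (ii)  weakly increasing tuples have flag critical lists, and UG ⊆ UGC
--        by (iv).
module Submission where

open import Defs
open import Data.Nat using (ℕ; zero; suc; _+_; _∸_; _≤_; _<_; _<ᵇ_; s≤s; _≤?_)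
open import Data.Nat.Properties
open import Data.Bool using (Bool; true; false; T)
open import Data.Unit using (tt)
open import Data.Maybe using (Maybe; just; nothing; maybe)
open import Data.List using (List; []; _∷_; _++_; reverse; zip; concatMap; map; [_])
open import Data.List.Properties using (++-assoc; ++-identityʳ; unfold-reverse)
open import Data.List.Membership.Propositional using (_∈_)
open import Data.List.Membership.Propositional.Properties using (∈-++⁺ˡ; ∈-++⁺ʳ; ∈-++⁻)
open import Data.List.Relation.Unary.Any using (here; there)
import Data.List.Relation.Unary.Any.Properties as AnyP
open import Data.List.Relation.Unary.All using (All; []; _∷_; lookup; tabulate) renaming (map to All-map)
import Data.List.Relation.Unary.All.Properties as AllP
open import Data.List.Relation.Unary.Linked using (Linked; []; [-]; _∷_) renaming (map to Linked-map; tail to Linked-tail)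
import Data.List.Relation.Unary.Linked.Properties as LinkedP
open import Data.Product using (_×_; _,_; proj₁; proj₂; ∃)
open import Data.Sum using (_⊎_; inj₁; inj₂) renaming (map₁ to ⊎-map₁)
open import Data.Empty using (⊥-elim)
open import Function using (flip)
open import Relation.Nullary using (¬_; yes; no)
open import Relation.Binary.PropositionalEquality hiding ([_])
open import Function.Bundles using (_⇔_; mk⇔; Equivalence)

<ᵇ-true : ∀ {m n} → (m <ᵇ n) ≡ true → m < n
<ᵇ-true {m} {n} e = <ᵇ⇒< m n (subst T (sym e) tt)

<ᵇ-false : ∀ {m n} → (m <ᵇ n) ≡ false → n ≤ m
<ᵇ-false {m} {n} e = ≮⇒≥ (λ m<n → subst T e (<⇒<ᵇ m<n))

data FindBelow (P : ℕ → Bool) (a y : ℕ) : Maybe ℕ → Set where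
  found : ∀ x → a < x → x < y → P x ≡ true →
          (∀ z → x < z → z < y → P z ≡ false) → FindBelow P a y (just x)
  none  : (∀ z → a < z → z < y → P z ≡ false) → FindBelow P a y nothing

false-below-suc : ∀ {P : ℕ → Bool} {y} z → z < suc y → P y ≡ false →
                  (z < y → P z ≡ false) → P z ≡ false
false-below-suc z z<1+y Py below with m<1+n⇒m<n∨m≡n z<1+y
... | inj₁ z<y = below z<y
... | inj₂ refl = Py

findBelow-spec : ∀ P a y → FindBelow P a y (findBelow P a y)
findBelow-spec P a zero = none (λ _ _ ())
findBelow-spec P a (suc y) with a <ᵇ y in a<ᵇy
... | false = none (λ z a<z z<1+y → ⊥-elim (<⇒≱ (<-≤-trans a<z (≤-pred z<1+y)) (<ᵇ-false a<ᵇy)))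
... | true with P y in Py
...   | true = found y (<ᵇ-true a<ᵇy) (n<1+n y) Py
                 (λ z y<z z<1+y → ⊥-elim (<⇒≱ y<z (≤-pred z<1+y)))
...   | false with findBelow P a y | findBelow-spec P a y
...     | .(just x) | found x a<x x<y Px above =
          found x a<x (m<n⇒m<1+n x<y) Px (λ z x<z z<1+y → false-below-suc z z<1+y Py (above z x<z))
...     | .nothing | none below =
          none (λ z a<z z<1+y → false-below-suc z z<1+y Py (below z a<z))

Jump : Tuple → ℕ → ℕ → Set
Jump υ x y = υ x + y < υ y + x

IsFirstGE : ℕ → List ℕ → ℕ → Set
IsFirstGE i L x = x ∈ L × i ≤ x × (∀ y → y ∈ L → i ≤ y → x ≤ y)

CoreLE : Tuple → List ℕ → ℕ → Set
CoreLE υ L i = ∃ λ x → IsFirstGE i L x × υ x + i ≤ υ i + x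

IsFirstGE-∷ : ∀ {i y L x} → x ≤ y → IsFirstGE i L x → IsFirstGE i (y ∷ L) x
IsFirstGE-∷ x≤y (x∈L , i≤x , least) =
  there x∈L , i≤x , λ { _ (here refl) _ → x≤y ; y' (there y'∈L) i≤y' → least y' y'∈L i≤y' }

IsFirstGE-head : ∀ {i y L} → i ≤ y → All (_< i) L → IsFirstGE i (y ∷ L) y
IsFirstGE-head i≤y below =
  here refl , i≤y ,
  λ { _ (here refl) _ → ≤-refl ; y' (there y'∈L) i≤y' → ⊥-elim (<⇒≱ (lookup below y'∈L) i≤y') }

JumpTest : Tuple → ℕ → ℕ → Bool
JumpTest υ y x = υ x + y <ᵇ υ y + x

noJump-bound : ∀ υ y z → z ≤ y → (z < y → JumpTest υ y z ≡ false) → υ y + z ≤ υ z + y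
noJump-bound υ y z z≤y noJump with m≤n⇒m<n∨m≡n z≤y
... | inj₁ z<y = <ᵇ-false (noJump z<y)
... | inj₂ refl = ≤-refl

record ChainSpec (υ : Tuple) (a y : ℕ) (D : List ℕ) : Set where
  field
    inCarrel   : All (λ z → a < z × z ≤ y) D
    descending : Linked (flip (λ x z → x < z × Jump υ x z)) D
    startsAt   : ∃ λ rest → D ≡ y ∷ rest
    coreBound  : ∀ z → a < z → z ≤ y → CoreLE υ D z

linked-cons : ∀ {S : ℕ → ℕ → Set} {y x rest D} → D ≡ x ∷ rest → S y x → Linked S D → Linked S (y ∷ D)
linked-cons refl s l = s ∷ l

chain-spec : ∀ υ a f y → a < y → y ≤ f → ChainSpec υ a y (chain υ a y f)
chain-spec υ a zero zero () _
chain-spec υ a zero (suc y) _ ()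
chain-spec υ a (suc f) y a<y y≤f
  with findBelow (JumpTest υ y) a y | findBelow-spec (JumpTest υ y) a y
... | .nothing | none noJump = record
  { inCarrel   = (a<y , ≤-refl) ∷ []
  ; descending = [-]
  ; startsAt   = [] , refl
  ; coreBound  = λ z a<z z≤y → y , IsFirstGE-head z≤y [] , noJump-bound υ y z z≤y (noJump z a<z) }
... | .(just x) | found x a<x x<y jump noJump = record
  { inCarrel   = (a<y , ≤-refl) ∷ All-map (λ (a<z , z≤x) → a<z , ≤-trans z≤x (<⇒≤ x<y)) (inCarrel below)
  ; descending = linked-cons (proj₂ (startsAt below)) (x<y , <ᵇ-true jump) (descending below)
  ; startsAt   = _ , refl
  ; coreBound  = bound }
  where
  open ChainSpec
  below : ChainSpec υ a x (chain υ a x f)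
  below = chain-spec υ a f x a<x (≤-pred (<-≤-trans x<y y≤f))
  bound : ∀ z → a < z → z ≤ y → CoreLE υ (y ∷ chain υ a x f) z
  bound z a<z z≤y with z ≤? x
  ... | yes z≤x with coreBound below z a<z z≤x
  ...   | x₀ , first , le = x₀ , IsFirstGE-∷ (≤-trans (proj₂ (lookup (inCarrel below) (proj₁ first))) (<⇒≤ x<y)) first , le
  bound z a<z z≤y | no z≰x =
    y , IsFirstGE-head z≤y (All-map (λ (_ , w≤x) → ≤-<-trans w≤x (≰⇒> z≰x)) (inCarrel below)) ,
    noJump-bound υ y z z≤y (noJump z (≰⇒> z≰x))

linked-reverse-++ : ∀ {S : ℕ → ℕ → Set} {x} xs ys →
                    Linked (flip S) (x ∷ xs) → Linked S (x ∷ ys) → Linked S (reverse xs ++ x ∷ ys)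
linked-reverse-++ [] ys _ l = l
linked-reverse-++ {S} {x} (y ∷ zs) ys (s ∷ l) l' =
  subst (Linked S) reassoc (linked-reverse-++ zs (x ∷ ys) l (s ∷ l'))
  where
  reassoc : reverse zs ++ y ∷ x ∷ ys ≡ reverse (y ∷ zs) ++ x ∷ ys
  reassoc = trans (sym (++-assoc (reverse zs) [ y ] (x ∷ ys)))
                  (cong (_++ x ∷ ys) (sym (unfold-reverse y zs)))

linked-reverse : ∀ {S : ℕ → ℕ → Set} xs → Linked (flip S) xs → Linked S (reverse xs)
linked-reverse [] _ = []
linked-reverse {S} (x ∷ xs) l =
  subst (Linked S) (sym (unfold-reverse x xs)) (linked-reverse-++ xs [] l [-])

record CarrelSpec (υ : Tuple) (a b : ℕ) (C : List ℕ) : Set where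
  field
    ascending : Linked (λ x y → x < y × Jump υ x y) C
    inCarrel  : All (λ z → a < z × z ≤ b) C
    endsAt    : ∃ λ X → C ≡ X ++ [ b ]
    coreBound : ∀ z → a < z → z ≤ b → CoreLE υ C z

IsFirstGE-reverse : ∀ {i L x} → IsFirstGE i L x → IsFirstGE i (reverse L) x
IsFirstGE-reverse (x∈L , i≤x , least) =
  AnyP.reverse⁺ x∈L , i≤x , λ y y∈L i≤y → least y (AnyP.reverse⁻ y∈L) i≤y

carrel-spec : ∀ υ a b → a < b → CarrelSpec υ a b (carrelCrit υ (a , b))
carrel-spec υ a b a<b = record
  { ascending = linked-reverse (chain υ a b b) (descending spec)
  ; inCarrel  = tabulate (λ z∈C → lookup (inCarrel spec) (AnyP.reverse⁻ z∈C))
  ; endsAt    = endsAt (startsAt spec)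
  ; coreBound = λ z a<z z≤b → let (x , first , le) = coreBound spec z a<z z≤b
                              in x , IsFirstGE-reverse first , le }
  where
  open ChainSpec
  spec : ChainSpec υ a b (chain υ a b b)
  spec = chain-spec υ a b b a<b ≤-refl
  endsAt : (∃ λ rest → chain υ a b b ≡ b ∷ rest) → ∃ λ X → reverse (chain υ a b b) ≡ X ++ [ b ]
  endsAt (rest , eq) = reverse rest , trans (cong reverse eq) (unfold-reverse b rest)

linked-join : ∀ {S : ℕ → ℕ → Set} X q M → Linked S (X ++ [ q ]) → Linked S (q ∷ M) →
              Linked S ((X ++ [ q ]) ++ M)
linked-join {S} X q M lX lM = subst (Linked S) (sym (++-assoc X [ q ] M)) (join X lX)
  where
  join : ∀ Y → Linked S (Y ++ [ q ]) → Linked S (Y ++ q ∷ M)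
  join [] _ = lM
  join (y ∷ []) (s ∷ _) = s ∷ lM
  join (y ∷ y' ∷ Y) (s ∷ l) = s ∷ join (y' ∷ Y) l

linked-prepend : ∀ {S : ℕ → ℕ → Set} {x ys} → Linked S ys → All (S x) ys → Linked S (x ∷ ys)
linked-prepend [] [] = [-]
linked-prepend [-] (s ∷ _) = s ∷ [-]
linked-prepend (s' ∷ l) (s ∷ _) = s ∷ s' ∷ l

IsFirstGE-++ˡ : ∀ {i C M x} → IsFirstGE i C x → All (x <_) M → IsFirstGE i (C ++ M) x
IsFirstGE-++ˡ {C = C} (x∈C , i≤x , least) above = ∈-++⁺ˡ x∈C , i≤x , least'
  where
  least' : ∀ y → y ∈ C ++ _ → _ ≤ y → _ ≤ y
  least' y y∈ i≤y with ∈-++⁻ C y∈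
  ... | inj₁ y∈C = least y y∈C i≤y
  ... | inj₂ y∈M = <⇒≤ (lookup above y∈M)

IsFirstGE-++ʳ : ∀ {i C M x} → All (_< i) C → IsFirstGE i M x → IsFirstGE i (C ++ M) x
IsFirstGE-++ʳ {C = C} below (x∈M , i≤x , least) = ∈-++⁺ʳ C x∈M , i≤x , least'
  where
  least' : ∀ y → y ∈ C ++ _ → _ ≤ y → _ ≤ y
  least' y y∈ i≤y with ∈-++⁻ C y∈
  ... | inj₁ y∈C = ⊥-elim (<⇒≱ (lookup below y∈C) i≤y)
  ... | inj₂ y∈M = least y y∈M i≤y

critFrom : Tuple → ℕ → ℕ → List ℕ → List ℕ
critFrom υ n a Q = concatMap (carrelCrit υ) (zip (a ∷ Q) (Q ++ n ∷ []))

CriticalStep : Tuple → (ℕ → Set) → ℕ → ℕ → Set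
CriticalStep υ P x y = x < y × (P x ⊎ Jump υ x y)

jumps⇒steps : ∀ {υ P C} → Linked (λ x y → x < y × Jump υ x y) C → Linked (CriticalStep υ P) C
jumps⇒steps = Linked-map (λ (x<y , jump) → x<y , inj₂ jump)

record CriticalSpec (υ : Tuple) (n a : ℕ) (P : ℕ → Set) (Q L : List ℕ) : Set where
  field
    ascending   : Linked (CriticalStep υ P) L
    inRange     : All (λ z → a < z × z ≤ n) L
    n∈          : n ∈ L
    boundaries∈ : All (_∈ L) Q
    coreBound   : ∀ z → a < z → z ≤ n → CoreLE υ L z

last∈ : ∀ {q : ℕ} {C : List ℕ} → (∃ λ X → C ≡ X ++ [ q ]) → q ∈ C
last∈ (X , refl) = ∈-++⁺ʳ X (here refl)

critFrom-spec : ∀ υ n (P : ℕ → Set) a Q → a < n → Linked _<_ (a ∷ Q) → All (_< n) Q → All P Q →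
                CriticalSpec υ n a P Q (critFrom υ n a Q)
critFrom-spec υ n P a [] a<n _ _ _ =
  subst (CriticalSpec υ n a P []) (sym (++-identityʳ (carrelCrit υ (a , n)))) record
    { ascending   = jumps⇒steps (ascending C)
    ; inRange     = inCarrel C
    ; n∈          = last∈ (endsAt C)
    ; boundaries∈ = []
    ; coreBound   = coreBound C }
  where
  open CarrelSpec
  C : CarrelSpec υ a n (carrelCrit υ (a , n))
  C = carrel-spec υ a n a<n
critFrom-spec υ n P a (q ∷ Q) a<n (a<q ∷ sorted) (q<n ∷ Q<n) (Pq ∷ PQ) = record
  { ascending   = subst (Linked _) (cong (_++ M) (sym C≡X∷q)) (linked-join X q M carrel-steps boundary-steps)
  ; inRange     = AllP.++⁺ (All-map (λ p → proj₁ p , ≤-trans (proj₂ p) (<⇒≤ q<n)) (inCarrel C))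
                           (All-map (λ p → <-trans a<q (proj₁ p) , proj₂ p) (inRange rest))
  ; n∈          = ∈-++⁺ʳ _ (n∈ rest)
  ; boundaries∈ = ∈-++⁺ˡ (last∈ (endsAt C)) ∷ All-map (∈-++⁺ʳ _) (boundaries∈ rest)
  ; coreBound   = bound }
  where
  open CarrelSpec
  open CriticalSpec
  M : List ℕ
  M = critFrom υ n q Q
  C : CarrelSpec υ a q (carrelCrit υ (a , q))
  C = carrel-spec υ a q a<q
  rest : CriticalSpec υ n q P Q M
  rest = critFrom-spec υ n P q Q q<n sorted Q<n PQ
  X : List ℕ
  X = proj₁ (endsAt C)
  C≡X∷q : carrelCrit υ (a , q) ≡ X ++ [ q ]
  C≡X∷q = proj₂ (endsAt C)
  carrel-steps : Linked (CriticalStep υ P) (X ++ [ q ])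
  carrel-steps = subst (Linked _) C≡X∷q (jumps⇒steps (ascending C))
  boundary-steps : Linked (CriticalStep υ P) (q ∷ M)
  boundary-steps = linked-prepend (ascending rest) (All-map (λ p → proj₁ p , inj₁ Pq) (inRange rest))
  inRestPart : ∀ {z} → q < z → CoreLE υ M z → CoreLE υ (carrelCrit υ (a , q) ++ M) z
  inRestPart q<z (x , first , le) =
    x , IsFirstGE-++ʳ (All-map (λ p → ≤-<-trans (proj₂ p) q<z) (inCarrel C)) first , le
  inCarrelPart : ∀ {z} → CoreLE υ (carrelCrit υ (a , q)) z → CoreLE υ (carrelCrit υ (a , q) ++ M) z
  inCarrelPart (x , first , le) =
    x , IsFirstGE-++ˡ first (All-map (λ p → ≤-<-trans x≤q (proj₁ p)) (inRange rest)) , le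
    where
    x≤q : x ≤ q
    x≤q = proj₂ (lookup (inCarrel C) (proj₁ first))
  bound : ∀ z → a < z → z ≤ n → CoreLE υ (carrelCrit υ (a , q) ++ M) z
  bound z a<z z≤n' with z ≤? q
  ... | yes z≤q = inCarrelPart (coreBound C z a<z z≤q)
  ... | no z≰q = inRestPart (≰⇒> z≰q) (coreBound rest z (≰⇒> z≰q) z≤n')

head-below : ∀ {y ys} → Linked _<_ (y ∷ ys) → All (y <_) ys
head-below [-] = []
head-below (y<z ∷ l) = LinkedP.Linked⇒All <-trans y<z l

firstGE-sound : ∀ {i x} L → Linked _<_ L → firstGE i L ≡ just x → IsFirstGE i L x
firstGE-sound {i} (y ∷ ys) sorted eq with y <ᵇ i in y<ᵇi
... | true  = IsFirstGE-∷-below (<ᵇ-true y<ᵇi) (firstGE-sound ys (Linked-tail sorted) eq)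
  where
  IsFirstGE-∷-below : ∀ {x} → y < i → IsFirstGE i ys x → IsFirstGE i (y ∷ ys) x
  IsFirstGE-∷-below y<i (x∈ , i≤x , least) =
    there x∈ , i≤x ,
    λ { _ (here refl) i≤y → ⊥-elim (<⇒≱ y<i i≤y) ; z (there z∈) i≤z → least z z∈ i≤z }
... | false with eq
...   | refl = IsFirstGE-head-sorted
  where
  IsFirstGE-head-sorted : IsFirstGE i (y ∷ ys) y
  IsFirstGE-head-sorted =
    here refl , <ᵇ-false y<ᵇi ,
    λ { _ (here refl) _ → ≤-refl ; z (there z∈) _ → <⇒≤ (lookup (head-below sorted) z∈) }

firstGE-complete : ∀ {i x} L → Linked _<_ L → IsFirstGE i L x → firstGE i L ≡ just x
firstGE-complete {i} {x} (y ∷ ys) sorted (x∈ , i≤x , least) with y <ᵇ i in y<ᵇi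
... | true  = firstGE-complete ys (Linked-tail sorted) (x∈ys x∈ , i≤x , λ z z∈ → least z (there z∈))
  where
  x∈ys : x ∈ y ∷ ys → x ∈ ys
  x∈ys (here refl) = ⊥-elim (<⇒≱ (<ᵇ-true y<ᵇi) i≤x)
  x∈ys (there x∈) = x∈
... | false = cong just (≤-antisym (y≤x x∈) (least y (here refl) (<ᵇ-false y<ᵇi)))
  where
  y≤x : x ∈ y ∷ ys → y ≤ x
  y≤x (here refl) = ≤-refl
  y≤x (there x∈) = <⇒≤ (lookup (head-below sorted) x∈)

firstGE-defined : ∀ {i z} L → z ∈ L → i ≤ z → ∃ λ x → firstGE i L ≡ just x
firstGE-defined {i} (y ∷ ys) z∈ i≤z with y <ᵇ i in y<ᵇi | z∈
... | true  | here refl = ⊥-elim (<⇒≱ (<ᵇ-true y<ᵇi) i≤z)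
... | true  | there z∈ys = firstGE-defined ys z∈ys i≤z
... | false | _ = y , refl

least-above : ∀ {i z} L → Linked _<_ L → z ∈ L → i ≤ z → ∃ λ x → IsFirstGE i L x
least-above L sorted z∈ i≤z =
  let (x , eq) = firstGE-defined L z∈ i≤z in x , firstGE-sound L sorted eq

data Consecutive : List ℕ → ℕ → ℕ → Set where
  adjacent : ∀ {x y L} → Consecutive (x ∷ y ∷ L) x y
  skip     : ∀ {z L x y} → Consecutive L x y → Consecutive (z ∷ L) x y

consecutive-rel : ∀ {S : ℕ → ℕ → Set} {L x y} → Linked S L → Consecutive L x y → S x y
consecutive-rel (s ∷ _) adjacent = s
consecutive-rel (_ ∷ l) (skip c) = consecutive-rel l c
consecutive-rel [-] (skip ())

consecutive⇒linked : ∀ {S : ℕ → ℕ → Set} L → (∀ {x y} → Consecutive L x y → S x y) → Linked S L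
consecutive⇒linked [] _ = []
consecutive⇒linked (x ∷ []) _ = [-]
consecutive⇒linked (x ∷ y ∷ L) s = s adjacent ∷ consecutive⇒linked (y ∷ L) (λ c → s (skip c))

consecutive-∈ : ∀ {L x y} → Consecutive L x y → x ∈ L × y ∈ L
consecutive-∈ adjacent = here refl , there (here refl)
consecutive-∈ (skip c) = let (x∈ , y∈) = consecutive-∈ c in there x∈ , there y∈

successor : ∀ {x z} L → Linked _<_ L → x ∈ L → z ∈ L → x < z → ∃ λ y → Consecutive L x y × y ≤ z
successor (w ∷ ws) sorted (here refl) (here refl) x<z = ⊥-elim (<-irrefl refl x<z)
successor (w ∷ v ∷ vs) sorted (here refl) (there (here refl)) _ = v , adjacent , ≤-refl
successor (w ∷ v ∷ vs) sorted (here refl) (there (there z∈)) _ =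
  v , adjacent , <⇒≤ (lookup (head-below (Linked-tail sorted)) z∈)
successor (w ∷ ws) sorted (there x∈) (here refl) x<z =
  ⊥-elim (<⇒≱ x<z (<⇒≤ (lookup (head-below sorted) x∈)))
successor (w ∷ ws) sorted (there x∈) (there z∈) x<z =
  let (y , c , y≤z) = successor ws (Linked-tail sorted) x∈ z∈ x<z in y , skip c , y≤z

consecutive-least : ∀ {L x y z} → Linked _<_ L → Consecutive L x y → z ∈ L → x < z → y ≤ z
consecutive-least sorted adjacent (here refl) x<z = ⊥-elim (<-irrefl refl x<z)
consecutive-least sorted adjacent (there (here refl)) _ = ≤-refl
consecutive-least sorted adjacent (there (there z∈)) _ = <⇒≤ (lookup (head-below (Linked-tail sorted)) z∈)
consecutive-least sorted (skip c) (here refl) x<z =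
  ⊥-elim (<⇒≱ x<z (<⇒≤ (lookup (head-below sorted) (proj₁ (consecutive-∈ c)))))
consecutive-least sorted (skip c) (there z∈) x<z = consecutive-least (Linked-tail sorted) c z∈ x<z

consecutive-IsFirstGE : ∀ {L x y j} → Linked _<_ L → Consecutive L x y → x < j → j ≤ y → IsFirstGE j L y
consecutive-IsFirstGE sorted c x<j j≤y =
  proj₂ (consecutive-∈ c) , j≤y , λ z z∈ j≤z → consecutive-least sorted c z∈ (<-≤-trans x<j j≤z)

-- The offset υ_x − x of a position; for upper tuples υ_x = slack υ x + x.
slack : Tuple → ℕ → ℕ
slack υ x = υ x ∸ x

∸-shift : ∀ {u x i} → i ≤ x → x ≤ u → u ∸ (x ∸ i) ≡ (u ∸ x) + i
∸-shift {u} {x} {i} i≤x x≤u = begin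
  u ∸ (x ∸ i)                 ≡⟨ cong (_∸ (x ∸ i)) (sym (m∸n+n≡m x≤u)) ⟩
  (u ∸ x) + x ∸ (x ∸ i)       ≡⟨ +-∸-assoc (u ∸ x) (m∸n≤m x i) ⟩
  (u ∸ x) + (x ∸ (x ∸ i))     ≡⟨ cong ((u ∸ x) +_) (m∸[m∸n]≡n i≤x) ⟩
  (u ∸ x) + i                 ∎
  where open ≡-Reasoning

jump⇒< : ∀ {u v x y} → x < y → u + y < v + x → u < v
jump⇒< {u} {v} {x} {y} x<y jump =
  +-cancelʳ-< y u v (<-≤-trans jump (+-monoʳ-≤ v (<⇒≤ x<y)))

jump⇒slack< : ∀ {u v x y} → x ≤ u → y ≤ v → u + y < v + x → u ∸ x < v ∸ y
jump⇒slack< {u} {v} {x} {y} x≤u y≤v jump = +-cancelʳ-< (x + y) (u ∸ x) (v ∸ y) (subst₂ _<_ lhs rhs jump)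
  where
  open ≡-Reasoning
  lhs : u + y ≡ u ∸ x + (x + y)
  lhs = begin
    u + y             ≡⟨ cong (_+ y) (sym (m∸n+n≡m x≤u)) ⟩
    u ∸ x + x + y     ≡⟨ +-assoc (u ∸ x) x y ⟩
    u ∸ x + (x + y)   ∎
  rhs : v + x ≡ v ∸ y + (x + y)
  rhs = begin
    v + x             ≡⟨ cong (_+ x) (sym (m∸n+n≡m y≤v)) ⟩
    v ∸ y + y + x     ≡⟨ +-assoc (v ∸ y) y x ⟩
    v ∸ y + (y + x)   ≡⟨ cong (v ∸ y +_) (+-comm y x) ⟩
    v ∸ y + (x + y)   ∎

-- If the core drops from b at x to c = a + 1 at x + 1, the gap length
-- s = b − c + 1 of the gapless condition equals b − a, and b − s = a.
gapLength : ∀ {a b c} → c ≡ suc a → c < b → (b ∸ c + 1 ≡ b ∸ a) × (b ∸ (b ∸ c + 1) ≡ a)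
gapLength {a} {b} refl c<b = s≡ , trans (cong (b ∸_) s≡) (m∸[m∸n]≡n (<⇒≤ (<-trans (n<1+n a) c<b)))
  where
  s≡ : b ∸ suc a + 1 ≡ b ∸ a
  s≡ = trans (+-comm (b ∸ suc a) 1) (sym (+-∸-assoc 1 (<⇒≤ c<b)))

strict-growth : ∀ (f : ℕ → ℕ) i d → (∀ j → i ≤ j → j < i + d → f j < f (suc j)) → f i + d ≤ f (i + d)
strict-growth f i zero _ rewrite +-identityʳ i | +-identityʳ (f i) = ≤-refl
strict-growth f i (suc d) step rewrite +-suc i d | +-suc (f i) d =
  ≤-trans (s≤s (strict-growth f i d (λ j i≤j j<i+d → step j i≤j (m<n⇒m<1+n j<i+d))))
          (step (i + d) (m≤m+n i d) (n<1+n (i + d)))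

weak-growth : ∀ (f : ℕ → ℕ) i d → (∀ j → i ≤ j → j < i + d → f j ≤ f (suc j)) → f i ≤ f (i + d)
weak-growth f i zero _ rewrite +-identityʳ i = ≤-refl
weak-growth f i (suc d) step rewrite +-suc i d =
  ≤-trans (weak-growth f i d (λ j i≤j j<i+d → step j i≤j (m<n⇒m<1+n j<i+d)))
          (step (i + d) (m≤m+n i d) (n<1+n (i + d)))

-- A core that runs affinely, D j = w + j on (q, k], and starts at
-- D q ≤ w + k satisfies the gapless condition at (q, q') for any q' ≥ k:
-- a drop at q is compensated within (q, k].
affine⇒GapCond : ∀ (D : Tuple) {q k q' w} → q < k → k ≤ q' → D q ≤ w + k →
                 (∀ j → q < j → j ≤ k → D j ≡ w + j) → GapCond D (q , q')
affine⇒GapCond D {q} {k} {q'} {w} q<k k≤q' Dq≤ run drop = s≤q'∸q , values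
  where
  Dsq : D (suc q) ≡ suc (w + q)
  Dsq = trans (run (suc q) ≤-refl q<k) (+-suc w q)
  gap : (D q ∸ D (suc q) + 1 ≡ D q ∸ (w + q)) × (D q ∸ (D q ∸ D (suc q) + 1) ≡ w + q)
  gap = gapLength Dsq drop
  s≤k∸q : D q ∸ D (suc q) + 1 ≤ k ∸ q
  s≤k∸q = subst (_≤ k ∸ q) (sym (proj₁ gap))
            (≤-trans (∸-monoˡ-≤ (w + q) Dq≤) (≤-reflexive ([m+n]∸[m+o]≡n∸o w k q)))
  s≤q'∸q : D q ∸ D (suc q) + 1 ≤ q' ∸ q
  s≤q'∸q = ≤-trans s≤k∸q (∸-monoˡ-≤ q k≤q')
  values : ∀ t → 1 ≤ t → t ≤ D q ∸ D (suc q) + 1 → D (q + t) ≡ (D q ∸ (D q ∸ D (suc q) + 1)) + t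
  values t 1≤t t≤s = begin
    D (q + t)                          ≡⟨ run (q + t) (m<m+n q 1≤t) q+t≤k ⟩
    w + (q + t)                        ≡⟨ sym (+-assoc w q t) ⟩
    w + q + t                          ≡⟨ cong (_+ t) (sym (proj₂ gap)) ⟩
    D q ∸ (D q ∸ D (suc q) + 1) + t    ∎
    where
    open ≡-Reasoning
    q+t≤k : q + t ≤ k
    q+t≤k = subst (_≤ k) (+-comm t q) (m≤o∸n⇒m+n≤o t (<⇒≤ q<k) (≤-trans t≤s s≤k∸q))

GapCond⇒run-continues : ∀ (D : Tuple) {x y q' w} → x < y → x < q' → w + y < D x →
                        (∀ j → x < j → j ≤ y → D j ≡ w + j) → GapCond D (x , q') →
                        suc y ≤ q' × D (suc y) ≡ w + suc y
GapCond⇒run-continues D {x} {y} {q'} {w} x<y x<q' w+y<Dx run gapless = suc-y≤q' , value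
  where
  open ≡-Reasoning
  Dsx : D (suc x) ≡ suc (w + x)
  Dsx = trans (run (suc x) ≤-refl x<y) (+-suc w x)
  drop : D (suc x) < D x
  drop = subst (_< D x) (sym Dsx) (≤-<-trans (≤-reflexive (sym (+-suc w x)))
                                     (≤-<-trans (+-monoʳ-≤ w x<y) w+y<Dx))
  gap : (D x ∸ D (suc x) + 1 ≡ D x ∸ (w + x)) × (D x ∸ (D x ∸ D (suc x) + 1) ≡ w + x)
  gap = gapLength Dsx drop
  -- the step t from x to y + 1 lies within the gap
  t : ℕ
  t = suc y ∸ x
  x+t : x + t ≡ suc y
  x+t = m+[n∸m]≡n (<⇒≤ (m<n⇒m<1+n x<y))
  t≤s : t ≤ D x ∸ D (suc x) + 1
  t≤s = subst (t ≤_) (sym (proj₁ gap))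
          (≤-trans (≤-reflexive (sym ([m+n]∸[m+o]≡n∸o w (suc y) x)))
                   (∸-monoˡ-≤ (w + x) (subst (_≤ D x) (sym (+-suc w y)) w+y<Dx)))
  suc-y≤q' : suc y ≤ q'
  suc-y≤q' = subst (_≤ q') (trans (+-comm t x) x+t)
               (m≤o∸n⇒m+n≤o t (<⇒≤ x<q') (≤-trans t≤s (proj₁ (gapless drop))))
  value : D (suc y) ≡ w + suc y
  value = begin
    D (suc y)                             ≡⟨ cong D (sym x+t) ⟩
    D (x + t)                             ≡⟨ proj₂ (gapless drop) t (m<n⇒0<n∸m (m<n⇒m<1+n x<y)) t≤s ⟩
    D x ∸ (D x ∸ D (suc x) + 1) + t       ≡⟨ cong (_+ t) (proj₂ gap) ⟩
    w + x + t                             ≡⟨ +-assoc w x t ⟩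
    w + (x + t)                           ≡⟨ cong (w +_) x+t ⟩
    w + suc y                             ∎

record NextBoundary (R : List ℕ) (n q q' : ℕ) : Set where
  field
    positive  : 1 ≤ q
    member    : q ∈ R
    ordered   : q < q'
    bounded   : q' ≤ n
    stops     : q' ∈ R ⊎ q' ≡ n
    next-in-R : ∀ r → r ∈ R → q < r → q' ≤ r

IsBoundaryPair : List ℕ → ℕ → ℕ × ℕ → Set
IsBoundaryPair R n (q , q') = NextBoundary R n q q'

boundaryPairs : ∀ n R → ValidR n R → All (IsBoundaryPair R n) (nextPairs R n)
boundaryPairs n [] _ = []
boundaryPairs n (q ∷ []) (_ , (1≤q , q<n) ∷ []) = record
  { positive = 1≤q ; member = here refl ; ordered = q<n ; bounded = ≤-refl ; stops = inj₂ refl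
  ; next-in-R = λ { _ (here refl) q<q → ⊥-elim (<-irrefl refl q<q) } } ∷ []
boundaryPairs n (q ∷ q' ∷ rest) (q<q' ∷ sorted , (1≤q , _) ∷ bounds@((_ , q'<n) ∷ _)) = record
  { positive = 1≤q ; member = here refl ; ordered = q<q' ; bounded = <⇒≤ q'<n
  ; stops = inj₁ (there (here refl)) ; next-in-R = next }
  ∷ All-map extend (boundaryPairs n (q' ∷ rest) (sorted , bounds))
  where
  above-q : All (q <_) (q' ∷ rest)
  above-q = q<q' ∷ All-map (<-trans q<q') (head-below sorted)
  next : ∀ r → r ∈ q ∷ q' ∷ rest → q < r → q' ≤ r
  next _ (here refl) q<q = ⊥-elim (<-irrefl refl q<q)
  next _ (there (here refl)) _ = ≤-refl
  next _ (there (there r∈)) _ = <⇒≤ (lookup (head-below sorted) r∈)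
  extend : ∀ {p} → IsBoundaryPair (q' ∷ rest) n p → IsBoundaryPair (q ∷ q' ∷ rest) n p
  extend {p , p'} b = record
    { positive = positive ; member = there member ; ordered = ordered ; bounded = bounded
    ; stops = ⊎-map₁ there stops
    ; next-in-R = λ { _ (here refl) p<q → ⊥-elim (<-asym p<q (lookup above-q member))
                   ; r (there r∈) p<r → next-in-R r r∈ p<r } }
    where open NextBoundary b

boundaryOf : ∀ {q} R n → q ∈ R → ∃ λ q' → (q , q') ∈ nextPairs R n
boundaryOf (q ∷ []) n (here refl) = n , here refl
boundaryOf (q ∷ q' ∷ rest) n (here refl) = q' , here refl
boundaryOf (q ∷ q' ∷ rest) n (there q∈) =
  let (q'' , p∈) = boundaryOf (q' ∷ rest) n q∈ in q'' , there p∈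

-- The core of υ computed from a list L of critical positions;
-- Δ R n υ is `core (criticalIndices R n υ) υ` by definition.
core : List ℕ → Tuple → Tuple
core L υ i = maybe (λ x → υ x ∸ (x ∸ i)) 0 (firstGE i L)

module Core (υ : Tuple) {R : List ℕ} {n : ℕ} {L : List ℕ} (spec : CriticalSpec υ n 0 (_∈ R) R L) where
  open CriticalSpec spec

  D : Tuple
  D = core L υ

  sorted : Linked _<_ L
  sorted = Linked-map proj₁ ascending

  coreValue : ∀ {i x} → IsFirstGE i L x → D i ≡ υ x ∸ (x ∸ i)
  coreValue first rewrite firstGE-complete L sorted first = refl

  first-critical : ∀ {i} → i ≤ n → ∃ λ x → IsFirstGE i L x
  first-critical = least-above L sorted n∈

  consecutive-step : ∀ {x y} → Consecutive L x y → x < y × (x ∈ R ⊎ Jump υ x y)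
  consecutive-step = consecutive-rel ascending

  boundary-ends∈ : ∀ {q q'} → NextBoundary R n q q' → q ∈ L × q' ∈ L
  boundary-ends∈ b = lookup boundaries∈ member , next∈ stops
    where
    open NextBoundary b
    next∈ : ∀ {q'} → q' ∈ R ⊎ q' ≡ n → q' ∈ L
    next∈ (inj₁ q'∈R) = lookup boundaries∈ q'∈R
    next∈ (inj₂ refl) = n∈

  module Upper (Uυ : U R n υ) where
    upper : ∀ {x} → x ∈ L → x ≤ υ x
    upper x∈ = let (0<x , x≤n) = lookup inRange x∈ in proj₂ Uυ _ 0<x x≤n

    value≤n : ∀ {x} → x ∈ L → υ x ≤ n
    value≤n x∈ = let (0<x , x≤n) = lookup inRange x∈ in proj₂ (proj₁ Uυ _ 0<x x≤n)

    core-affine : ∀ {i x} → IsFirstGE i L x → D i ≡ slack υ x + i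
    core-affine first@(x∈ , i≤x , _) = trans (coreValue first) (∸-shift i≤x (upper x∈))

    core-critical : ∀ {x} → x ∈ L → D x ≡ υ x
    core-critical x∈ = trans (core-affine (x∈ , ≤-refl , λ _ _ le → le)) (m∸n+n≡m (upper x∈))

    core-run : ∀ {x y} → Consecutive L x y → ∀ j → x < j → j ≤ y → D j ≡ slack υ y + j
    core-run c j x<j j≤y = core-affine (consecutive-IsFirstGE sorted c x<j j≤y)

    critical-step : ∀ {x} → x ∈ L → x < n → ¬ (x ∈ R) → slack υ x + suc x < D (suc x)
    critical-step {x} x∈ x<n x∉R with successor L sorted x∈ n∈ x<n
    ... | y , c , _ with consecutive-step c
    ...   | _ , inj₁ x∈R = ⊥-elim (x∉R x∈R)
    ...   | x<y , inj₂ jump =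
      subst (slack υ x + suc x <_) (sym (core-run c (suc x) ≤-refl x<y))
        (+-monoˡ-< (suc x) (jump⇒slack< (upper x∈) (upper (proj₂ (consecutive-∈ c))) jump))

    core-bounds : ∀ {i} → i ≤ n → i ≤ D i × D i ≤ n
    core-bounds i≤n with first-critical i≤n
    ... | x , first@(x∈ , i≤x , _) rewrite core-affine first =
      m≤n+m _ _ , ≤-trans (+-monoʳ-≤ (slack υ x) i≤x) (≤-trans (≤-reflexive (m∸n+n≡m (upper x∈))) (value≤n x∈))

    core-UI : UI R n D
    core-UI = ((λ i 1≤i i≤n → ≤-trans 1≤i (proj₁ (core-bounds i≤n)) , proj₂ (core-bounds i≤n))
              , (λ i _ i≤n → proj₁ (core-bounds i≤n)))
            , increasing
      where
      increasing : ∀ i → 1 ≤ i → i < n → ¬ (i ∈ R) → D i < D (suc i)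
      increasing i _ i<n i∉R with first-critical (<⇒≤ i<n)
      ... | x , first@(x∈ , i≤x , least) with x ≟ i
      ...   | yes refl =
        subst (_< D (suc i)) (trans (m∸n+n≡m (upper x∈)) (sym (core-critical x∈)))
          (<-trans (+-monoʳ-< (slack υ i) (n<1+n i)) (critical-step x∈ i<n i∉R))
      ...   | no x≢i =
        subst₂ _<_ (sym (core-affine first)) (sym (core-affine first′)) (+-monoʳ-< (slack υ x) (n<1+n i))
        where
        first′ : IsFirstGE (suc i) L x
        first′ = x∈ , ≤∧≢⇒< i≤x (λ i≡x → x≢i (sym i≡x)) , λ z z∈ i<z → least z z∈ (<⇒≤ i<z)

    flag⇒gapless : All (IsBoundaryPair R n) (nextPairs R n) →
                   Linked _≤_ (map υ L) → All (GapCond D) (nextPairs R n)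
    flag⇒gapless boundaries flag = tabulate (λ {p} p∈ → gapless-at p (lookup boundaries p∈))
      where
      gapless-at : ∀ p → IsBoundaryPair R n p → GapCond D p
      gapless-at (q , q') b
        with successor L sorted (proj₁ (boundary-ends∈ b)) (proj₂ (boundary-ends∈ b)) (NextBoundary.ordered b)
      ... | k , c , k≤q' = affine⇒GapCond D (proj₁ (consecutive-step c)) k≤q' Dq≤ (core-run c)
        where
        Dq≤ : D q ≤ slack υ k + k
        Dq≤ = subst₂ _≤_ (sym (core-critical (proj₁ (boundary-ends∈ b))))
                         (sym (m∸n+n≡m (upper (proj₂ (consecutive-∈ c)))))
                         (consecutive-rel (LinkedP.map⁻ flag) c)

    -- Part (iii), ⇐: a drop υ_y < υ_x from a boundary x to its next critical
    -- index y is impossible for a gapless core, since the gap condition would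
    -- extend the run (x, y] past y, whereas y ∉ R is critical, so the core
    -- rises by more than one after y.
    no-drop-at-boundary : All (IsBoundaryPair R n) (nextPairs R n) → All (GapCond D) (nextPairs R n) →
                          ∀ {x y} → Consecutive L x y → x ∈ R → ¬ (υ y < υ x)
    no-drop-at-boundary boundaries gapless {x} {y} c x∈R υy<υx =
      <-irrefl (sym Dsy) (critical-step y∈ (<-≤-trans y<q' bounded) y∉R)
      where
      q' : ℕ
      q' = proj₁ (boundaryOf R n x∈R)
      p∈ : (x , q') ∈ nextPairs R n
      p∈ = proj₂ (boundaryOf R n x∈R)
      b : NextBoundary R n x q'
      b = lookup boundaries p∈
      open NextBoundary b
      x<y : x < y
      x<y = proj₁ (consecutive-step c)
      y∈ : y ∈ L
      y∈ = proj₂ (consecutive-∈ c)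
      w+y<Dx : slack υ y + y < D x
      w+y<Dx = subst₂ _<_ (sym (m∸n+n≡m (upper y∈))) (sym (core-critical (proj₁ (consecutive-∈ c)))) υy<υx
      continues : suc y ≤ q' × D (suc y) ≡ slack υ y + suc y
      continues = GapCond⇒run-continues D x<y ordered w+y<Dx (core-run c) (lookup gapless p∈)
      y<q' : y < q'
      y<q' = proj₁ continues
      Dsy : D (suc y) ≡ slack υ y + suc y
      Dsy = proj₂ continues
      y∉R : ¬ (y ∈ R)
      y∉R y∈R = <⇒≱ y<q' (next-in-R y y∈R x<y)

    gapless⇒flag : All (IsBoundaryPair R n) (nextPairs R n) →
                   All (GapCond D) (nextPairs R n) → Linked _≤_ (map υ L)
    gapless⇒flag boundaries gapless = LinkedP.map⁺ (consecutive⇒linked L rises)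
      where
      rises : ∀ {x y} → Consecutive L x y → υ x ≤ υ y
      rises {x} {y} c with consecutive-step c
      ... | x<y , inj₂ jump = <⇒≤ (jump⇒< x<y jump)
      ... | _ , inj₁ x∈R with υ x ≤? υ y
      ...   | yes υx≤υy = υx≤υy
      ...   | no υx≰υy = ⊥-elim (no-drop-at-boundary boundaries gapless c x∈R (≰⇒> υx≰υy))

  -- Between
  -- i and its first critical index x there is no boundary, so υ grows by at
  -- least x − i, while the core bound says it grows by at most that much.
  core-fixes-UI : UI R n υ → ∀ i → 1 ≤ i → i ≤ n → D i ≡ υ i
  core-fixes-UI UIυ i 1≤i i≤n with coreBound i 1≤i i≤n
  ... | x , first@(x∈ , i≤x , least) , bound = begin
    D i                          ≡⟨ coreValue first ⟩
    υ x ∸ (x ∸ i)                ≡⟨ cong (_∸ (x ∸ i)) (≤-antisym grows-at-most grows-at-least) ⟩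
    υ i + (x ∸ i) ∸ (x ∸ i)      ≡⟨ m+n∸n≡m (υ i) (x ∸ i) ⟩
    υ i                          ∎
    where
    open ≡-Reasoning
    i+d≡x : i + (x ∸ i) ≡ x
    i+d≡x = m+[n∸m]≡n i≤x
    step : ∀ j → i ≤ j → j < i + (x ∸ i) → υ j < υ (suc j)
    step j i≤j j<i+d = proj₂ UIυ j (≤-trans 1≤i i≤j) (<-≤-trans j<x (proj₂ (lookup inRange x∈)))
                         (λ j∈R → <⇒≱ j<x (least j (lookup boundaries∈ j∈R) i≤j))
      where
      j<x : j < x
      j<x = subst (j <_) i+d≡x j<i+d
    grows-at-least : υ i + (x ∸ i) ≤ υ x
    grows-at-least = subst (λ k → υ i + (x ∸ i) ≤ υ k) i+d≡x (strict-growth υ i (x ∸ i) step)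
    grows-at-most : υ x ≤ υ i + (x ∸ i)
    grows-at-most = +-cancelʳ-≤ i (υ x) (υ i + (x ∸ i))
      (subst (υ x + i ≤_) (trans (cong (υ i +_) (sym (m∸n+n≡m i≤x))) (sym (+-assoc (υ i) (x ∸ i) i))) bound)

  UF⇒flag : UF R n υ → Linked _≤_ (map υ L)
  UF⇒flag UFυ = LinkedP.map⁺ (consecutive⇒linked L rises)
    where
    rises : ∀ {x y} → Consecutive L x y → υ x ≤ υ y
    rises {x} {y} c = subst (λ k → υ x ≤ υ k) (m+[n∸m]≡n x≤y) (weak-growth υ x (y ∸ x) step)
      where
      x≤y : x ≤ y
      x≤y = <⇒≤ (proj₁ (consecutive-step c))
      step : ∀ j → x ≤ j → j < x + (y ∸ x) → υ j ≤ υ (suc j)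
      step j x≤j j<x+d =
        proj₂ UFυ j (≤-trans (proj₁ (lookup inRange (proj₁ (consecutive-∈ c)))) x≤j)
                    (<-≤-trans (subst (j <_) (m+[n∸m]≡n x≤y) j<x+d) (proj₂ (lookup inRange (proj₂ (consecutive-∈ c)))))

UI-cong : ∀ {R n} {f g : Tuple} → (∀ i → 1 ≤ i → i ≤ n → f i ≡ g i) → UI R n f → UI R n g
UI-cong {n = n} eq ((inRange , upper) , increasing) =
  ( (λ i 1≤i i≤n → subst (λ v → 1 ≤ v × v ≤ n) (eq i 1≤i i≤n) (inRange i 1≤i i≤n))
  , (λ i 1≤i i≤n → subst (i ≤_) (eq i 1≤i i≤n) (upper i 1≤i i≤n)) )
  , λ i 1≤i i<n i∉R → subst₂ _<_ (eq i 1≤i (<⇒≤ i<n)) (eq (suc i) (≤-trans 1≤i (n≤1+n i)) i<n)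
                                (increasing i 1≤i i<n i∉R)

GapCond-cong : ∀ {f g : Tuple} {q q'} → (∀ i → 1 ≤ i → i ≤ q' → f i ≡ g i) → 1 ≤ q → q < q' →
               GapCond f (q , q') → GapCond g (q , q')
GapCond-cong {f} {g} {q} {q'} eq 1≤q q<q' gapless
  rewrite sym (eq q 1≤q (<⇒≤ q<q')) | sym (eq (suc q) (≤-trans 1≤q (n≤1+n q)) q<q') =
  λ drop → proj₁ (gapless drop) , λ t 1≤t t≤s →
    trans (sym (eq (q + t) (≤-trans 1≤q (m≤m+n q t)) (q+t≤q' drop t≤s))) (proj₂ (gapless drop) t 1≤t t≤s)
  where
  q+t≤q' : ∀ {t} → (drop : f (suc q) < f q) → t ≤ f q ∸ f (suc q) + 1 → q + t ≤ q'
  q+t≤q' {t} drop t≤s = subst (_≤ q') (+-comm t q) (m≤o∸n⇒m+n≤o t (<⇒≤ q<q') (≤-trans t≤s (proj₁ (gapless drop))))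

UG-cong : ∀ {R n} {f g : Tuple} → All (IsBoundaryPair R n) (nextPairs R n) →
          (∀ i → 1 ≤ i → i ≤ n → f i ≡ g i) → UG R n f → UG R n g
UG-cong {R} {n} {f} {g} boundaries eq (UIf , gapless) =
  UI-cong eq UIf , tabulate (λ {p} p∈ → cong-at p (lookup boundaries p∈) (lookup gapless p∈))
  where
  cong-at : ∀ p → IsBoundaryPair R n p → GapCond f p → GapCond g p
  cong-at (q , q') b = GapCond-cong (λ i 1≤i i≤q' → eq i 1≤i (≤-trans i≤q' bounded)) positive ordered
    where open NextBoundary b

criticalSpec : ∀ υ n R → 1 ≤ n → ValidR n R → CriticalSpec υ n 0 (_∈ R) R (criticalIndices R n υ)
criticalSpec υ n R 1≤n (sorted , bounds) =
  critFrom-spec υ n (_∈ R) 0 R 1≤n (linked-prepend sorted (All-map proj₁ bounds))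
                (All-map proj₂ bounds) (tabulate (λ q∈ → q∈))

proposition4p2 : (n : ℕ) → 1 ≤ n → (R : List ℕ) → ValidR n R →
    ((υ : Tuple) → U R n υ → UI R n (Δ R n υ))
    × ((η : Tuple) → UGC R n η → UG R n (Δ R n η))
    × ((φ : Tuple) → UF R n φ → UG R n (Δ R n φ))
    × ((γ : Tuple) → UG R n γ → UGC R n γ)
    × ((φ : Tuple) → UF R n φ → UGC R n φ)
    × ((υ : Tuple) → U R n υ → (FlagCritical R n υ ⇔ UGC R n υ))
    × ((α : Tuple) → UI R n α → (FlagCritical R n α ⇔ UG R n α))
proposition4p2 n 1≤n R valid = core-UI , (λ _ → proj₂) , UF⇒gapless-core , UG⊆UGC , UF⊆UGC , flag⇔UGC , flag⇔UG
  where
  boundaries : All (IsBoundaryPair R n) (nextPairs R n)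
  boundaries = boundaryPairs n R valid
  module C (υ : Tuple) = Core υ (criticalSpec υ n R 1≤n valid)

  core-UI : (υ : Tuple) → U R n υ → UI R n (Δ R n υ)
  core-UI υ Uυ = C.Upper.core-UI υ Uυ

  flag⇔UGC : (υ : Tuple) → U R n υ → (FlagCritical R n υ ⇔ UGC R n υ)
  flag⇔UGC υ Uυ = mk⇔ (λ flag → Uυ , core-UI υ Uυ , C.Upper.flag⇒gapless υ Uυ boundaries flag)
                      (λ UGCυ → C.Upper.gapless⇒flag υ Uυ boundaries (proj₂ (proj₂ UGCυ)))

  UF⊆UGC : (φ : Tuple) → UF R n φ → UGC R n φ
  UF⊆UGC φ UFφ = Equivalence.to (flag⇔UGC φ (proj₁ UFφ)) (C.UF⇒flag φ UFφ)

  UF⇒gapless-core : (φ : Tuple) → UF R n φ → UG R n (Δ R n φ)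
  UF⇒gapless-core φ UFφ = proj₂ (UF⊆UGC φ UFφ)

  UG⊆UGC : (γ : Tuple) → UG R n γ → UGC R n γ
  UG⊆UGC γ UGγ = proj₁ (proj₁ UGγ) ,
    UG-cong boundaries (λ i 1≤i i≤n → sym (C.core-fixes-UI γ (proj₁ UGγ) i 1≤i i≤n)) UGγ

  flag⇔UG : (α : Tuple) → UI R n α → (FlagCritical R n α ⇔ UG R n α)
  flag⇔UG α UIα = mk⇔
    (λ flag → UG-cong boundaries (C.core-fixes-UI α UIα) (proj₂ (Equivalence.to (flag⇔UGC α (proj₁ UIα)) flag)))
    (λ UGα → Equivalence.from (flag⇔UGC α (proj₁ UIα)) (UG⊆UGC α UGα))
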